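{- Let $X$, $Y$ be finite nonempty sets, $F: X\to 2^Y$ a set-valued mapping, and $(W_1,\ldots,W_m)$ a Hall partition of $F$ such that $F^p(x)$ is a singleton for each $x\in X$. Then $m = \sharp X$.
   Context: A set-valued mapping $F: X \to 2^Y$ assigns to each $x$ a (possibly empty) subset $F(x) \subset Y$; $F(W) = \bigcup_{x\in W}F(x)$; $\sharp$ is cardinality. For $W \subset X$, $F_W: X\setminus W \to 2^Y$ is $F_W(x) = F(x) \setminus F(W)$ ($F_\emptyset=F$). For set-valued $G$ on a finite set, a subset $W$ of its domain is critical for $G$ if $W\ne\emptyset$ and $\sharp G(W)=\sharp W$; non-reducible for $G$ if $W\ne\emptyset$ and no proper subset of $W$ is critical for $G$. A tuple $(W_1,\ldots,W_m)$, $m\ge1$, is a Hall partition of $F$ if the $W_i$ are nonempty, pairwise disjoint with union $X$, and with $G_i = F_{W_1\cup\cdots\cup W_{i-1}}$ ($G_1=F$): (i) $G_i(x)\neq\emptyset$ for $x \in W_i$; (ii) $W_i$ is non-reducible for $G_i$; (iii) $W_i$ is critical for $G_i$ for $i \le m-1$. Given a Hall partition, $F^p(x) = G_i(x)$ for $x\in W_i$. -}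

module Defs where

open import Data.Nat as ℕ using (ℕ; suc; _<_)
open import Data.Fin using (Fin; toℕ)
open import Data.Fin.Subset
open import Data.Fin.Subset.Properties using (_∈?_)
open import Data.List using (List; map; filter; allFin)
open import Data.Product using (Σ; ∃; _×_)
open import Relation.Nullary using (¬_)
open import Relation.Binary.PropositionalEquality using (_≡_; _≢_)

SetMap : ℕ → ℕ → Set
SetMap n k = Fin n → Subset k

image : {n k : ℕ} → SetMap n k → Subset n → Subset k
image {n} F W = ⋃ (map F (filter (_∈? W) (allFin n)))

-- F_W(x) = F(x) \ F(W)   (only meaningful / only used for x ∉ W)
restrictMap : {n k : ℕ} → SetMap n k → Subset n → SetMap n k
restrictMap F W x = F x ─ image F W

Critical : {n k : ℕ} → SetMap n k → Subset n → Set
Critical G W = Nonempty W × ∣ image G W ∣ ≡ ∣ W ∣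

NonReducible : {n k : ℕ} → SetMap n k → Subset n → Set
NonReducible G W = Nonempty W × (∀ V → V ⊂ W → ¬ Critical G V)

-- W₁ ∪ ... ∪ W_{i-1}  (indices 0-based: union of W j with j < i)
prefixUnion : {n m : ℕ} → (Fin m → Subset n) → Fin m → Subset n
prefixUnion {n} {m} W i =
  ⋃ (map W (filter (λ j → toℕ j ℕ.<? toℕ i) (allFin m)))

stageMap : {n k m : ℕ} → SetMap n k → (Fin m → Subset n) → Fin m → SetMap n k
stageMap F W i = restrictMap F (prefixUnion W i)

record HallPartition {n k m : ℕ} (F : SetMap n k) (W : Fin m → Subset n) : Set where
  field
    m-pos      : 1 ℕ.≤ m
    nonempty   : ∀ i → Nonempty (W i)
    disjoint   : ∀ i j → i ≢ j → W i ∩ W j ≡ ⊥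
    covers     : ∀ (x : Fin n) → ∃ λ i → x ∈ W i
    cond-i     : ∀ i x → x ∈ W i → Nonempty (stageMap F W i x)
    cond-ii    : ∀ i → NonReducible (stageMap F W i) (W i)
    cond-iii   : ∀ i → suc (toℕ i) < m → Critical (stageMap F W i) (W i)

-- F^p(x) = G_i(x) for x ∈ W_i ; "F^p(x) is a singleton for every x"
AllSingletonPruned : {n k m : ℕ} → SetMap n k → (Fin m → Subset n) → Set
AllSingletonPruned F W = ∀ i x → x ∈ W i → ∣ stageMap F W i x ∣ ≡ 1

{-# OPTIONS --safe #-}
-- Each block W i of the partition is non-reducible for G i and G i takes singleton
-- values on it, so every singleton ⁅ x ⁆ ⊆ W i is already critical; non-reducibility
-- then forbids W i from having a second element. Thus the blocks are m pairwise
-- disjoint singletons covering X, and choosing an element of each block and the block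
-- of each element give injections both ways between Fin m and Fin n.
module Submission where

open import Defs
open import Data.Nat using (ℕ; _≤_)
open import Data.Fin using (Fin; _≟_)
open import Data.Fin.Properties using (cantor-schröder-bernstein)
open import Data.Fin.Subset
open import Data.Fin.Subset.Properties
open import Data.List using (List; []; _∷_; allFin)
import Data.List.Membership.Propositional as List
open import Data.List.Membership.Propositional.Properties
  using (∈-map⁺; ∈-map⁻; ∈-filter⁺; ∈-filter⁻; ∈-allFin)
open import Data.List.Relation.Unary.Any using (here; there)
open import Data.Product using (∃; _×_; _,_; proj₁; proj₂)
open import Data.Sum using (inj₁; inj₂)
open import Function.Definitions using (Injective)
open import Relation.Nullary using (yes; no; contradiction)
open import Relation.Binary.PropositionalEquality
  using (_≡_; _≢_; refl; sym; trans; subst; cong)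

⊆-⋃ : ∀ {k} {s : Subset k} (ss : List (Subset k)) → s List.∈ ss → s ⊆ ⋃ ss
⊆-⋃ (t ∷ ss) (here refl) y∈s = x∈p∪q⁺ (inj₁ y∈s)
⊆-⋃ (t ∷ ss) (there s∈ss) y∈s = x∈p∪q⁺ (inj₂ (⊆-⋃ ss s∈ss y∈s))

∈-⋃⁻ : ∀ {k} {y : Fin k} (ss : List (Subset k)) → y ∈ ⋃ ss → ∃ λ s → s List.∈ ss × y ∈ s
∈-⋃⁻ [] y∈ = contradiction y∈ ∉⊥
∈-⋃⁻ (t ∷ ss) y∈ with x∈p∪q⁻ t (⋃ ss) y∈
... | inj₁ y∈t = t , here refl , y∈t
... | inj₂ y∈⋃ss with ∈-⋃⁻ ss y∈⋃ss
...   | s , s∈ss , y∈s = s , there s∈ss , y∈s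

image-⁅⁆ : ∀ {n k} (G : SetMap n k) (x : Fin n) → image G ⁅ x ⁆ ≡ G x
image-⁅⁆ {n} G x = ⊆-antisym image⊆ ⊆image
  where
  image⊆ : image G ⁅ x ⁆ ⊆ G x
  image⊆ y∈ with ∈-⋃⁻ _ y∈
  ... | s , s∈ , y∈s with ∈-map⁻ G s∈
  ...   | z , z∈ , refl with x∈⁅y⁆⇒x≡y x (proj₂ (∈-filter⁻ (_∈? ⁅ x ⁆) {xs = allFin n} z∈))
  ...     | refl = y∈s
  ⊆image : G x ⊆ image G ⁅ x ⁆
  ⊆image = ⊆-⋃ _ (∈-map⁺ G (∈-filter⁺ (_∈? ⁅ x ⁆) (∈-allFin x) (x∈⁅x⁆ x)))

singleton-critical : ∀ {n k} (G : SetMap n k) (x : Fin n) → ∣ G x ∣ ≡ 1 → Critical G ⁅ x ⁆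
singleton-critical G x ∣Gx∣≡1 =
  (x , x∈⁅x⁆ x) , trans (cong ∣_∣ (image-⁅⁆ G x)) (trans ∣Gx∣≡1 (sym (∣⁅x⁆∣≡1 x)))

nonReducible-singletonValued-unique : ∀ {n k} {G : SetMap n k} {W : Subset n} →
  NonReducible G W → (∀ x → x ∈ W → ∣ G x ∣ ≡ 1) →
  ∀ {x y} → x ∈ W → y ∈ W → x ≡ y
nonReducible-singletonValued-unique {G = G} {W} (_ , noCritical) singleton {x} {y} x∈W y∈W
  with x ≟ y
... | yes x≡y = x≡y
... | no x≢y = contradiction (singleton-critical G x (singleton x x∈W)) (noCritical ⁅ x ⁆ ⁅x⁆⊂W)
  where
  ⁅x⁆⊂W : ⁅ x ⁆ ⊂ W
  ⁅x⁆⊂W = (λ z∈⁅x⁆ → subst (_∈ W) (sym (x∈⁅y⁆⇒x≡y _ z∈⁅x⁆)) x∈W)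
        , y , y∈W , x≢y⇒x∉⁅y⁆ (λ y≡x → x≢y (sym y≡x))

choice-injective : ∀ {n m} (W : Fin m → Subset n) →
  (∀ i j → i ≢ j → W i ∩ W j ≡ ⊥) → (pick : ∀ i → Nonempty (W i)) →
  Injective _≡_ _≡_ (λ i → proj₁ (pick i))
choice-injective W disjoint pick {i} {j} same with i ≟ j
... | yes i≡j = i≡j
... | no i≢j = contradiction (subst (proj₁ (pick i) ∈_) (disjoint i j i≢j) both) ∉⊥
  where
  both = x∈p∩q⁺ (proj₂ (pick i) , subst (_∈ W j) (sym same) (proj₂ (pick j)))

lemma7p3 : (n k m : ℕ) → 1 ≤ n → 1 ≤ k →
    (F : SetMap n k) → (W : Fin m → Subset n) →
    HallPartition F W → AllSingletonPruned F W → m ≡ n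
lemma7p3 n k m _ _ F W hp singleton =
  cantor-schröder-bernstein (choice-injective W disjoint nonempty) block-injective
  where
  open HallPartition hp
  block : Fin n → Fin m
  block x = proj₁ (covers x)
  block-injective : Injective _≡_ _≡_ block
  block-injective {x} {y} same =
    nonReducible-singletonValued-unique (cond-ii (block y)) (singleton (block y))
      (subst (λ i → x ∈ W i) same (proj₂ (covers x))) (proj₂ (covers y))
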